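{- Let $A\in\mathcal C$ and let $X$ be a finite independent subset of $A$. Then there is a finite independent subset $Y$ of $A$ with $X\subseteq Y$ such that $A\setminus{\rm desc}(Y)$ is finite.
   Context: For $s\ge0$ an $s$-arc from $u_0$ to $u_s$ is a sequence $u_0\ldots u_s$ with $(u_i,u_{i+1})$ edges and $u_{i-1}\ne u_{i+1}$ for $0<i<s$; ${\rm desc}(u)$ is the set of vertices reachable from $u$ by an $s$-arc for some $s\ge0$, ${\rm desc}(X)=\bigcup_{x\in X}{\rm desc}(x)$; descendant sets are computed in $A$ and regarded as induced subdigraphs. A subset of a digraph is independent if the descendant sets of any two distinct members are disjoint. A subset $S$ of a digraph is finitely generated if $S={\rm desc}(F)$ for some finite $F$. Fix an integer $q\ge2$ and let $T$ be the $q$-valent rooted tree (vertices: finite sequences over $\{0,\ldots,q-1\}$; edges $(\bar w,\bar wi)$). $\mathcal C$ is the class of digraphs $A$ such that ${\rm desc}(a)\cong T$ for all $a\in A$, $A$ is finitely generated, and ${\rm desc}(a)\cap{\rm desc}(b)$ is finitely generated for all $a,b\in A$. -}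

module Defs where

open import Data.Nat using (ℕ; zero; suc; _∸_; _<_; _≤_)
open import Data.Fin using (Fin)
open import Data.List using (List; []; _∷_; _++_; [_])
open import Data.List.Membership.Propositional using (_∈_)
open import Data.List.Relation.Unary.Any using (Any)
open import Data.Product using (Σ; ∃; _×_; _,_)
open import Relation.Binary.PropositionalEquality using (_≡_; _≢_)
open import Relation.Nullary using (¬_)
open import Function.Bundles using (_⇔_)
open import Data.Unit using (⊤)

record Digraph : Set₁ where
  field
    V    : Set
    Edge : V → V → Set
open Digraph public

module _ (A : Digraph) where

  record IsArc (s : ℕ) (f : ℕ → V A) (u v : V A) : Set where
    field
      start    : f 0 ≡ u
      end      : f s ≡ v
      edges    : ∀ i → i < s → Edge A (f i) (f (suc i))
      noReturn : ∀ i → 0 < i → i < s → f (i ∸ 1) ≢ f (suc i)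

  Desc : V A → V A → Set
  Desc u v = ∃ λ s → ∃ λ f → IsArc s f u v

  DescL : List (V A) → V A → Set
  DescL F v = Any (λ x → Desc x v) F

  FinitelyGenerated : (V A → Set) → Set
  FinitelyGenerated S = ∃ λ (F : List (V A)) → ∀ v → S v ⇔ DescL F v

  Independent : List (V A) → Set
  Independent X = ∀ x y → x ∈ X → y ∈ X → x ≢ y → ∀ v → ¬ (Desc x v × Desc y v)

  FiniteSubset : (V A → Set) → Set
  FiniteSubset S = ∃ λ (L : List (V A)) → ∀ v → S v → v ∈ L

TVert : ℕ → Set
TVert q = List (Fin q)

TEdge : (q : ℕ) → TVert q → TVert q → Set
TEdge q w w' = ∃ λ (i : Fin q) → w' ≡ w ++ [ i ]

-- desc(a) (induced subdigraph of A, descendants computed in A) is isomorphic to T: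
-- an injective map ψ from T onto desc(a) preserving and reflecting edges.
record DescIsoT (q : ℕ) (A : Digraph) (a : V A) : Set where
  field
    ψ      : TVert q → V A
    ψ-in   : ∀ t → Desc A a (ψ t)
    ψ-inj  : ∀ t t' → ψ t ≡ ψ t' → t ≡ t'
    ψ-onto : ∀ v → Desc A a v → ∃ λ t → ψ t ≡ v
    ψ-edge : ∀ t t' → Edge A (ψ t) (ψ t') ⇔ TEdge q t t'

record InC (q : ℕ) (A : Digraph) : Set where
  field
    descT  : ∀ a → DescIsoT q A a
    finGen : FinitelyGenerated A (λ _ → ⊤)
    capFG  : ∀ a b → FinitelyGenerated A (λ v → Desc A a v × Desc A b v)

-- Let F be a finite generating set of A. The generators are treated one at a time, enlarging
-- the independent set Y. For a generator f, identify desc(f) with the tree T. For each y ∈ Y,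
-- desc(f) ∩ desc(y) is generated by finitely many vertices; choose N exceeding the depths of
-- their tree coordinates and adjoin to Y the images of all words of length N extending none of
-- these coordinates. Cones of distinct words of equal length are disjoint, and a cone at depth N
-- meeting desc(y) meets it below a generator of desc(f) ∩ desc(y), whose coordinate would then be
-- a prefix of the word. Afterwards every vertex of desc(f) at depth ≥ N lies in desc(Y), so only
-- the finitely many vertices of depth < N can remain uncovered.
module Submission where

open import Defs
open import Data.Nat using (ℕ; zero; suc; _∸_; _≤_; _<_; z≤n; s≤s; s≤s⁻¹; _≤?_; _<?_)
open import Data.Nat.Properties
open import Data.Fin using (fromℕ<) renaming (_≟_ to _≟ᶠ_)
open import Data.Fin.Properties using (toℕ-fromℕ<)
open import Data.List using (List; []; _∷_; _++_; [_]; length; take; drop; lookup; map; filter; concatMap; allFin; upTo; cartesianProductWith)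
open import Data.List.Properties using (length-++; ++-identityʳ; ++-assoc; ++-conicalˡ; ∷-injectiveˡ; ∷-injectiveʳ; take-suc; take-all; take++drop≡id; length-take)
open import Data.List.Extrema ≤-totalOrder using (max; v≤max⁺)
open import Data.List.Membership.Propositional using (_∈_; mapWith∈; find; lose)
open import Data.List.Membership.Propositional.Properties using (∈-map⁺; ∈-map⁻; ∈-++⁺ˡ; ∈-++⁺ʳ; ∈-++⁻; ∈-filter⁺; ∈-filter⁻; ∈-allFin; ∈-upTo⁺; ∈-concatMap⁺; ∈-concatMap⁻; ∈-cartesianProductWith⁺; ∈-cartesianProductWith⁻)
open import Data.List.Relation.Unary.Any using (Any; here; there; any?)
open import Data.List.Relation.Unary.Any.Properties using (mapWith∈⁺; mapWith∈⁻)
open import Data.List.Relation.Binary.Subset.Propositional using (_⊆_)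
open import Data.List.Relation.Binary.Subset.Propositional.Properties using (Any-resp-⊆; xs⊆xs++ys)
open import Data.List.Relation.Binary.Pointwise using (Pointwise-≡⇒≡)
open import Data.List.Relation.Binary.Prefix.Heterogeneous using (Prefix; []; _∷_)
open import Data.List.Relation.Binary.Prefix.Heterogeneous.Properties using (toPointwise; prefix?) renaming (trans to Prefix-trans)
open import Data.List.Relation.Binary.Prefix.Propositional.Properties using (Prefix-as-∣ˡ; ∣ˡ-as-Prefix)
open import Data.Product using (∃; ∃₂; _×_; _,_; proj₁; proj₂)
open import Data.Sum using (inj₁; inj₂)
open import Data.Unit using (tt)
open import Relation.Nullary using (¬_; Dec; yes; no; ¬?; contradiction)
open import Relation.Binary.PropositionalEquality using (_≡_; _≢_; refl; sym; trans; cong; subst; subst₂)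
open import Function using (_∘_)
open import Function.Bundles using (_⇔_; Equivalence)

module _ {X : Set} where

  ++≡++⇒Prefix : ∀ (w p : List X) {s s′} → w ++ s ≡ p ++ s′ → length w ≤ length p →
                 Prefix _≡_ w p
  ++≡++⇒Prefix []      p       _ _       = []
  ++≡++⇒Prefix (x ∷ w) (y ∷ p) e (s≤s l) = ∷-injectiveˡ e ∷ ++≡++⇒Prefix w p (∷-injectiveʳ e) l

  take-prefix : ∀ n (t : List X) → Prefix _≡_ (take n t) t
  take-prefix n t = ∣ˡ-as-Prefix record { quotient = drop n t ; equality = take++drop≡id n t }

words : ∀ q → ℕ → List (TVert q)
words q zero    = [ [] ]
words q (suc n) = cartesianProductWith _∷_ (allFin q) (words q n)

∈-words⁺ : ∀ {q n} {t : TVert q} → length t ≡ n → t ∈ words q n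
∈-words⁺ {t = []}    refl = here refl
∈-words⁺ {t = i ∷ t} refl = ∈-cartesianProductWith⁺ _∷_ (∈-allFin i) (∈-words⁺ refl)

∈-words⁻ : ∀ {q} n {t : TVert q} → t ∈ words q n → length t ≡ n
∈-words⁻ zero    (here refl) = refl
∈-words⁻ (suc n) t∈
  with _ , _ , _ , t∈′ , refl ← ∈-cartesianProductWith⁻ _∷_ (allFin _) (words _ n) t∈ =
  cong suc (∈-words⁻ n t∈′)

shorterWords : ∀ q → ℕ → List (TVert q)
shorterWords q n = concatMap (words q) (upTo n)

∈-shorterWords : ∀ {q n} {t : TVert q} → length t < n → t ∈ shorterWords q n
∈-shorterWords {q} l = ∈-concatMap⁺ (words q) (lose (∈-upTo⁺ l) (∈-words⁺ refl))

module Arcs (A : Digraph) where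
  open IsArc

  desc-refl : ∀ x → Desc A x x
  desc-refl x = 0 , (λ _ → x) , record { start = refl ; end = refl ; edges = λ _ () ; noReturn = λ _ _ () }

  IsArc-resp : ∀ {s f u v u′ v′} → u ≡ u′ → v ≡ v′ → IsArc A s f u v → IsArc A s f u′ v′
  IsArc-resp refl refl ar = ar

  arc-prefix : ∀ {s f u v} j → j ≤ s → IsArc A s f u v → IsArc A j f u (f j)
  arc-prefix j j≤s ar = record
    { start    = start ar
    ; end      = refl
    ; edges    = λ i i<j → edges ar i (<-≤-trans i<j j≤s)
    ; noReturn = λ i 0<i i<j → noReturn ar i 0<i (<-≤-trans i<j j≤s) }

  arc-vertex-desc : ∀ {s f u v} → IsArc A s f u v → ∀ j → j ≤ s → Desc A u (f j)
  arc-vertex-desc ar j j≤s = j , _ , arc-prefix j j≤s ar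

  snocAt : ℕ → (ℕ → V A) → V A → ℕ → V A
  snocAt n g w j with j ≤? n
  ... | yes _ = g j
  ... | no  _ = w

  snocAt-≤ : ∀ n g w {j} → j ≤ n → snocAt n g w j ≡ g j
  snocAt-≤ n g w {j} j≤n with j ≤? n
  ... | yes _   = refl
  ... | no  j≰n = contradiction j≤n j≰n

  snocAt-> : ∀ n g w {j} → n < j → snocAt n g w j ≡ w
  snocAt-> n g w {j} n<j with j ≤? n
  ... | yes j≤n = contradiction j≤n (<⇒≱ n<j)
  ... | no  _   = refl

  arc-snoc : ∀ {n g u v w} → IsArc A n g u v → Edge A v w → (0 < n → g (n ∸ 1) ≢ w) →
             IsArc A (suc n) (snocAt n g w) u w
  arc-snoc {n} {g} {w = w} ar v→w notBack = record
    { start    = trans (at≤ z≤n) (start ar)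
    ; end      = at> ≤-refl
    ; edges    = edges′
    ; noReturn = noReturn′ }
    where
    at≤ : ∀ {j} → j ≤ n → snocAt n g w j ≡ g j
    at≤ = snocAt-≤ n g w
    at> : ∀ {j} → n < j → snocAt n g w j ≡ w
    at> = snocAt-> n g w
    edges′ : ∀ i → i < suc n → Edge A (snocAt n g w i) (snocAt n g w (suc i))
    edges′ i i<1+n with m≤n⇒m<n∨m≡n (s≤s⁻¹ i<1+n)
    ... | inj₁ i<n  = subst₂ (Edge A) (sym (at≤ (<⇒≤ i<n))) (sym (at≤ i<n)) (edges ar i i<n)
    ... | inj₂ refl = subst₂ (Edge A) (sym (trans (at≤ ≤-refl) (end ar))) (sym (at> ≤-refl)) v→w
    noReturn′ : ∀ i → 0 < i → i < suc n → snocAt n g w (i ∸ 1) ≢ snocAt n g w (suc i)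
    noReturn′ i 0<i i<1+n eq with m≤n⇒m<n∨m≡n (s≤s⁻¹ i<1+n)
    ... | inj₁ i<n  = noReturn ar i 0<i i<n
                        (trans (sym (at≤ (≤-trans (m∸n≤m i 1) (<⇒≤ i<n)))) (trans eq (at≤ i<n)))
    ... | inj₂ refl = notBack 0<i (trans (sym (at≤ (m∸n≤m i 1))) (trans eq (at> ≤-refl)))

module Coordinates {q : ℕ} {A : Digraph} {a : V A} (iso : DescIsoT q A a) where
  open DescIsoT iso
  open Arcs A
  open IsArc

  TEdge-length : ∀ {t t′} → TEdge q t t′ → length t′ ≡ suc (length t)
  TEdge-length {t} (i , refl) = trans (length-++ t) (+-comm (length t) 1)

  ψ-pathArc : ∀ s (c : ℕ → TVert q) → (∀ i → i < s → TEdge q (c i) (c (suc i))) →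
              IsArc A s (ψ ∘ c) (ψ (c 0)) (ψ (c s))
  ψ-pathArc s c step = record
    { start    = refl
    ; end      = refl
    ; edges    = λ i i<s → Equivalence.from (ψ-edge (c i) (c (suc i))) (step i i<s)
    ; noReturn = noReturn′ }
    where
    -- Lengths strictly increase along a tree path, so it never revisits a vertex.
    noReturn′ : ∀ i → 0 < i → i < s → ψ (c (i ∸ 1)) ≢ ψ (c (suc i))
    noReturn′ (suc j) _ 1+j<s eq = <⇒≢ (m<n⇒m<1+n (n<1+n _))
      (trans (cong length (ψ-inj _ _ eq))
        (trans (TEdge-length (step (suc j) 1+j<s)) (cong suc (TEdge-length (step j (<-trans (n<1+n j) 1+j<s))))))

  ψ-++-arc : ∀ p r → IsArc A (length r) (λ i → ψ (p ++ take i r)) (ψ p) (ψ (p ++ r))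
  ψ-++-arc p r = IsArc-resp (cong ψ (++-identityʳ p)) (cong (ψ ∘ (p ++_)) (take-all (length r) r ≤-refl))
                   (ψ-pathArc (length r) (λ i → p ++ take i r) step)
    where
    step : ∀ i → i < length r → TEdge q (p ++ take i r) (p ++ take (suc i) r)
    step i i<∣r∣ = subst (λ j → TEdge q (p ++ take j r) (p ++ take (suc j) r)) (toℕ-fromℕ< i<∣r∣)
      (lookup r k , trans (cong (p ++_) (take-suc r k)) (sym (++-assoc p _ _)))
      where k = fromℕ< i<∣r∣

  desc-ψ-++ : ∀ p r → Desc A (ψ p) (ψ (p ++ r))
  desc-ψ-++ p r = length r , _ , ψ-++-arc p r

  desc-ψ-≼ : ∀ {w t} → Prefix _≡_ w t → Desc A (ψ w) (ψ t)
  desc-ψ-≼ w≼t with record { quotient = r ; equality = refl } ← Prefix-as-∣ˡ w≼t = desc-ψ-++ _ r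

  arc-from-ψ-extends : ∀ {s h u₀ v} → IsArc A s h (ψ u₀) v →
                       (∀ i → i < s → ∀ u → h i ≡ ψ u → Desc A a (h (suc i))) →
                       ∀ i → i ≤ s → ∃ λ r → h i ≡ ψ (u₀ ++ r)
  arc-from-ψ-extends {u₀ = u₀} ar closed zero _ = [] , trans (start ar) (cong ψ (sym (++-identityʳ u₀)))
  arc-from-ψ-extends {u₀ = u₀} ar closed (suc i) i<s =
    let r , hi≡ = arc-from-ψ-extends ar closed i (<⇒≤ i<s)
        t , ψt≡ = ψ-onto _ (closed i i<s _ hi≡)
        x , t≡ = Equivalence.to (ψ-edge (u₀ ++ r) t) (subst₂ (Edge A) hi≡ (sym ψt≡) (edges ar i i<s))
    in r ++ [ x ] , trans (sym ψt≡) (cong ψ (trans t≡ (++-assoc u₀ r [ x ])))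

  -- An arc from a = ψ t₀ to ψ [] stays inside desc a, so [] extends t₀.
  ψ-root : ψ [] ≡ a
  ψ-root =
    let t₀ , ψt₀≡a = ψ-onto a (desc-refl a)
        s , h , a→ψ[] = ψ-in []
        r , eq = arc-from-ψ-extends (IsArc-resp (sym ψt₀≡a) refl a→ψ[])
                   (λ i i<s _ _ → arc-vertex-desc a→ψ[] (suc i) i<s) s ≤-refl
    in trans (cong ψ (sym (++-conicalˡ t₀ r (ψ-inj _ _ (trans (sym eq) (end a→ψ[])))))) ψt₀≡a

  -- The edge cannot go back to the parent of u because ψ reflects edges, so it extends the
  -- arc from a to ψ u.
  ψ-edge-desc : ∀ u {w} → Edge A (ψ u) w → Desc A a w
  ψ-edge-desc u {w} ψu→w =
    suc (length u) , _ , arc-snoc (IsArc-resp ψ-root refl (ψ-++-arc [] u)) ψu→w notParent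
    where
    notParent : 0 < length u → ψ (take (length u ∸ 1) u) ≢ w
    notParent _ refl with x , eq ← Equivalence.to (ψ-edge u _) ψu→w =
      <⇒≢ (s≤s (subst (_≤ length u) (sym (length-take (length u ∸ 1) u)) (m⊓n≤n _ _)))
          (TEdge-length {u} (x , eq))

  desc-ψ-extends : ∀ p {v} → Desc A (ψ p) v → ∃ λ s → v ≡ ψ (p ++ s)
  desc-ψ-extends p (s , h , ar) =
    let r , eq = arc-from-ψ-extends ar closed s ≤-refl in r , trans (sym (end ar)) eq
    where
    closed : ∀ i → i < s → ∀ u → h i ≡ ψ u → Desc A a (h (suc i))
    closed i i<s u hi≡ψu = ψ-edge-desc u (subst (λ x → Edge A x (h (suc i))) hi≡ψu (edges ar i i<s))

  desc-ψ-⊆-desc-root : ∀ p {v} → Desc A (ψ p) v → Desc A a v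
  desc-ψ-⊆-desc-root p d = let s , v≡ = desc-ψ-extends p d in subst (Desc A a) (sym v≡) (ψ-in (p ++ s))

  desc-ψ-meet⇒≼ : ∀ {w p v} → length w ≤ length p → Desc A (ψ w) v → Desc A (ψ p) v →
                  Prefix _≡_ w p
  desc-ψ-meet⇒≼ {w} {p} l dw dp =
    let s , v≡ = desc-ψ-extends w dw ; s′ , v≡′ = desc-ψ-extends p dp
    in ++≡++⇒Prefix w p (ψ-inj _ _ (trans (sym v≡) v≡′)) l

  desc-ψ-meet⇒≡ : ∀ {p p′ v} → length p ≡ length p′ → Desc A (ψ p) v → Desc A (ψ p′) v →
                  p ≡ p′
  desc-ψ-meet⇒≡ l dp dp′ = Pointwise-≡⇒≡ (toPointwise l (desc-ψ-meet⇒≼ (≤-reflexive l) dp dp′))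

module Construction {q : ℕ} {A : Digraph} (C : InC q A) where
  open Arcs A
  open InC C

  module Step (f : V A) (Y : List (V A)) where
    open DescIsoT (descT f)
    open Coordinates (descT f)

    meet : V A → List (V A)
    meet y = proj₁ (capFG f y)

    meet-⇔ : ∀ y v → (Desc A f v × Desc A y v) ⇔ DescL A (meet y) v
    meet-⇔ y = proj₂ (capFG f y)

    meet-sound : ∀ {y g v} → g ∈ meet y → Desc A g v → Desc A f v × Desc A y v
    meet-sound g∈ d = Equivalence.from (meet-⇔ _ _) (lose g∈ d)

    coordinate : ∀ {g} → Desc A f g → TVert q
    coordinate d = proj₁ (ψ-onto _ d)

    wall : List (TVert q)
    wall = concatMap (λ y → mapWith∈ (meet y) (λ g∈ → coordinate (proj₁ (meet-sound g∈ (desc-refl _)))))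
                     Y

    wall-complete : ∀ {y g} → y ∈ Y → g ∈ meet y → ∃ λ w → w ∈ wall × ψ w ≡ g
    wall-complete {g = g} y∈ g∈ =
      _ , ∈-concatMap⁺ _ (lose y∈ (mapWith∈⁺ _ (g , g∈ , refl))) , proj₂ (ψ-onto g _)

    wall-sound : ∀ {w} → w ∈ wall → ∃ λ y → y ∈ Y × ψ w ∈ meet y
    wall-sound w∈ =
      let y , y∈ , w∈′ = find (∈-concatMap⁻ _ w∈)
          g , g∈ , w≡ = mapWith∈⁻ (meet y) _ w∈′
      in y , y∈ , subst (_∈ meet y) (sym (trans (cong ψ w≡) (proj₂ (ψ-onto g _)))) g∈

    depth : ℕ
    depth = suc (max 0 (map length wall))

    wall-shallow : ∀ {w} → w ∈ wall → length w < depth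
    wall-shallow w∈ = s≤s (v≤max⁺ 0 _ (inj₂ (lose (∈-map⁺ length w∈) ≤-refl)))

    Blocked : TVert q → Set
    Blocked p = Any (λ w → Prefix _≡_ w p) wall

    blocked? : ∀ p → Dec (Blocked p)
    blocked? p = any? (λ w → prefix? _≟ᶠ_ w p) wall

    fresh : List (TVert q)
    fresh = filter (¬? ∘ blocked?) (words q depth)

    fresh-depth : ∀ {p} → p ∈ fresh → length p ≡ depth
    fresh-depth p∈ = ∈-words⁻ depth (proj₁ (∈-filter⁻ (¬? ∘ blocked?) {xs = words q depth} p∈))

    fresh-unblocked : ∀ {p} → p ∈ fresh → ¬ Blocked p
    fresh-unblocked p∈ = proj₂ (∈-filter⁻ (¬? ∘ blocked?) {xs = words q depth} p∈)

    extended : List (V A)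
    extended = Y ++ map ψ fresh

    shallow : List (V A)
    shallow = map ψ (shorterWords q depth)

    fresh-disjoint-old : ∀ {y p v} → y ∈ Y → p ∈ fresh → Desc A y v → ¬ Desc A (ψ p) v
    fresh-disjoint-old {y} {p} y∈ p∈ dy dp =
      let g , g∈ , dg = find (Equivalence.to (meet-⇔ y _) (desc-ψ-⊆-desc-root p dp , dy))
          w , w∈ , ψw≡g = wall-complete y∈ g∈
          w<p = subst (length w <_) (sym (fresh-depth p∈)) (wall-shallow w∈)
          dψw = subst (λ x → Desc A x _) (sym ψw≡g) dg
      in fresh-unblocked p∈ (lose w∈ (desc-ψ-meet⇒≼ (<⇒≤ w<p) dψw dp))

    extended-independent : Independent A Y → Independent A extended
    extended-independent indY x y x∈ y∈ x≢y v (dx , dy) with ∈-++⁻ Y x∈ | ∈-++⁻ Y y∈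
    ... | inj₁ x∈Y | inj₁ y∈Y = indY x y x∈Y y∈Y x≢y v (dx , dy)
    ... | inj₁ x∈Y | inj₂ y∈new with _ , p∈ , refl ← ∈-map⁻ ψ y∈new = fresh-disjoint-old x∈Y p∈ dx dy
    ... | inj₂ x∈new | inj₁ y∈Y with _ , p∈ , refl ← ∈-map⁻ ψ x∈new = fresh-disjoint-old y∈Y p∈ dy dx
    ... | inj₂ x∈new | inj₂ y∈new
      with _ , p∈ , refl ← ∈-map⁻ ψ x∈new | _ , p′∈ , refl ← ∈-map⁻ ψ y∈new =
      x≢y (cong ψ (desc-ψ-meet⇒≡ (trans (fresh-depth p∈) (sym (fresh-depth p′∈))) dx dy))

    deep-covered : ∀ t → depth ≤ length t → DescL A extended (ψ t)
    deep-covered t depth≤ with blocked? (take depth t)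
    ... | yes blocked =
      let w , w∈ , w≼p = find blocked
          y , y∈ , ψw∈ = wall-sound w∈
          w≼t = Prefix-trans trans w≼p (take-prefix depth t)
      in lose (xs⊆xs++ys Y _ y∈) (proj₂ (meet-sound ψw∈ (desc-ψ-≼ w≼t)))
    ... | no unblocked =
      lose (∈-++⁺ʳ Y (∈-map⁺ ψ p∈)) (desc-ψ-≼ (take-prefix depth t))
      where
      p∈ : take depth t ∈ fresh
      p∈ = ∈-filter⁺ (¬? ∘ blocked?)
             (∈-words⁺ (trans (length-take depth t) (m≤n⇒m⊓n≡m depth≤))) unblocked

    extended-covers : ∀ {v} → Desc A f v → ¬ DescL A extended v → v ∈ shallow
    extended-covers d ∉ with t , refl ← ψ-onto _ d with length t <? depth
    ... | yes t<depth = ∈-map⁺ ψ (∈-shorterWords t<depth)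
    ... | no  t≮depth = contradiction (deep-covered t (≮⇒≥ t≮depth)) ∉

  extend-all : (F Y : List (V A)) → Independent A Y →
               ∃₂ λ Y′ L → Y ⊆ Y′ × Independent A Y′ ×
                 (∀ {f v} → f ∈ F → Desc A f v → ¬ DescL A Y′ v → v ∈ L)
  extend-all []      Y indY = Y , [] , (λ y∈ → y∈) , indY , λ ()
  extend-all (f ∷ F) Y indY with extend-all F (Step.extended f Y) (Step.extended-independent f Y indY)
  ... | Y′ , L , ext⊆Y′ , indY′ , covers =
    Y′ , Step.shallow f Y ++ L , ext⊆Y′ ∘ xs⊆xs++ys Y _ , indY′ , covers′
    where
    covers′ : ∀ {f′ v} → f′ ∈ f ∷ F → Desc A f′ v → ¬ DescL A Y′ v → v ∈ Step.shallow f Y ++ L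
    covers′ (here refl) d ∉ = ∈-++⁺ˡ (Step.extended-covers f Y d (∉ ∘ Any-resp-⊆ ext⊆Y′))
    covers′ (there f∈)  d ∉ = ∈-++⁺ʳ (Step.shallow f Y) (covers f∈ d ∉)

lemma3p1 : (q : ℕ) → 2 ≤ q → (A : Digraph) → InC q A →
           (X : List (V A)) → Independent A X →
           ∃ λ (Y : List (V A)) →
             (∀ x → x ∈ X → x ∈ Y) × Independent A Y ×
             FiniteSubset A (λ v → ¬ DescL A Y v)
lemma3p1 q _ A C X indX =
  let F , generates = InC.finGen C
      Y , L , X⊆Y , indY , covers = Construction.extend-all C F X indX
      uncovered⊆L : ∀ v → ¬ DescL A Y v → v ∈ L
      uncovered⊆L v ∉ = let f , f∈ , d = find (Equivalence.to (generates v) tt) in covers f∈ d ∉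
  in Y , (λ _ → X⊆Y) , indY , L , uncovered⊆L
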